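{- For all $n\ge 2$, $\overline{q}_n(132,213,321)=2n$.
   Context: For a positive integer $n$, let $\mathcal{S}_{n,n}$ denote the set of all permutations (words) $\pi=\pi_1\cdots\pi_{2n}$ of the multiset $\{1,1,2,2,\ldots,n,n\}$. A word $\pi$ contains a pattern $\sigma=\sigma_1\cdots\sigma_k$ if there are indices $i_1<\cdots<i_k$ such that $\pi_{i_a}=\pi_{i_b}$ iff $\sigma_a=\sigma_b$ and $\pi_{i_a}<\pi_{i_b}$ iff $\sigma_a<\sigma_b$ for all $a,b$; otherwise $\pi$ avoids $\sigma$. The quasi-Stirling permutations $\overline{\mathcal{Q}}_n$ are the $\pi\in\mathcal{S}_{n,n}$ avoiding both $1212$ and $2121$. For a set $\Lambda$ of patterns, $\overline{\mathcal{Q}}_n(\Lambda)$ is the set of $\pi\in\overline{\mathcal{Q}}_n$ avoiding every pattern in $\Lambda$, and $\overline{q}_n(\Lambda)=|\overline{\mathcal{Q}}_n(\Lambda)|$. -}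

module Defs where

open import Data.Nat using (ℕ; zero; suc; _+_; _*_; _≡ᵇ_; _<ᵇ_)
open import Data.Bool using (Bool; true; false; _∧_; _∨_; not; if_then_else_)
open import Data.List using (List; []; _∷_; map; concatMap; length; filter; upTo; _++_)
open import Data.Bool.ListAction using (all; any)
open import Relation.Nullary.Decidable using (T?)
open import Data.Nat.Properties using (_≟_)
open import Relation.Nullary.Decidable using (⌊_⌋)
open import Data.Bool.Properties using () renaming (_≟_ to _≟ᵇ_)

words : ℕ → ℕ → List (List ℕ)
words zero    n = [] ∷ []
words (suc k) n = concatMap (λ w → map (λ i → suc i ∷ w) (upTo n)) (words k n)

occ : ℕ → List ℕ → ℕ
occ a []       = zero
occ a (x ∷ w) = if a ≡ᵇ x then suc (occ a w) else occ a w

-- π is a permutation of the multiset {1,1,2,2,…,n,n}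
-- (given π is a word of length 2n over {1..n}): each letter occurs exactly twice
isMultiperm : ℕ → List ℕ → Bool
isMultiperm n π = all (λ i → occ (suc i) π ≡ᵇ 2) (upTo n)

subseqs : List ℕ → List (List ℕ)
subseqs []       = [] ∷ []
subseqs (x ∷ w) = map (x ∷_) (subseqs w) ++ subseqs w

-- entry at position i (0-based), default 0
at : List ℕ → ℕ → ℕ
at []      _       = 0
at (x ∷ _) zero    = x
at (_ ∷ w) (suc i) = at w i

orderIso : List ℕ → List ℕ → Bool
orderIso τ σ =
  (length τ ≡ᵇ length σ) ∧
  all (λ a → all (λ b →
        ((at τ a ≡ᵇ at τ b) ≟ᵇB (at σ a ≡ᵇ at σ b)) ∧
        ((at τ a <ᵇ at τ b) ≟ᵇB (at σ a <ᵇ at σ b)))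
      (upTo (length σ))) (upTo (length σ))
  where
  _≟ᵇB_ : Bool → Bool → Bool
  x ≟ᵇB y = ⌊ x ≟ᵇ y ⌋

contains : List ℕ → List ℕ → Bool
contains π σ = any (λ τ → orderIso τ σ) (subseqs π)

avoids : List ℕ → List ℕ → Bool
avoids π σ = not (contains π σ)

avoidsAll : List ℕ → List (List ℕ) → Bool
avoidsAll π Λ = all (avoids π) Λ

-- quasi-Stirling permutations of {1,1,…,n,n} avoiding every pattern in Λ
Qbar : ℕ → List (List ℕ) → List (List ℕ)
Qbar n Λ = filter (λ π → T? (isMultiperm n π ∧ avoidsAll π ((1 ∷ 2 ∷ 1 ∷ 2 ∷ []) ∷ (2 ∷ 1 ∷ 2 ∷ 1 ∷ []) ∷ Λ))) (words (2 * n) n)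

qbar : ℕ → List (List ℕ) → ℕ
qbar n Λ = length (Qbar n Λ)

module Submission where

-- An avoiding word splits as π = A B with A and B weakly increasing, every letter of B
-- at most every letter of A, and the cut at a strict descent; this is built by prepending
-- one letter at a time, every way of breaking the shape exhibiting one of 132, 213, 321,
-- 1212, 2121. When each of 1, …, n occurs twice, sortedness and letter counts pin the runs
-- down: if A starts with m, then A = m m ⋯ n n and B = 1 1 ⋯ (m-1)(m-1), or one copy of m
-- moves to the end of B. These are the 2n rotations of 1 1 2 2 ⋯ n n, which conversely
-- avoid all five patterns and are pairwise distinct when n ≥ 2.

open import Data.Bool using (Bool; true; false; T; not; _∧_)
open import Data.Bool.ListAction using (all)
open import Data.Bool.Properties using (T-∧; T-≡) renaming (_≟_ to _≟ᵇ_)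
open import Data.Empty using (⊥-elim)
open import Data.List using (List; []; _∷_; _++_; [_]; length; map; upTo; concatMap; head)
open import Data.List.Membership.Propositional using (_∈_; _∉_; find; lose)
open import Data.List.Membership.Propositional.Properties
  using (∈-++⁺ˡ; ∈-++⁺ʳ; ∈-++⁻; ∈-map⁺; ∈-map⁻; ∈-upTo⁺; ∈-upTo⁻;
         ∈-concatMap⁺; ∈-concatMap⁻; ∈-filter⁺; ∈-filter⁻)
open import Data.List.Membership.Propositional.Properties.WithK using (unique∧set⇒bag)
open import Data.List.Properties using (++-identityʳ; ++-assoc; ∷-injectiveʳ; length-upTo)
open import Data.List.Relation.Binary.BagAndSetEquality using (∼bag⇒↭)
open import Data.List.Relation.Binary.Permutation.Propositional as ↭
  using (_↭_; ↭-trans; ↭-reflexive)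
open import Data.List.Relation.Binary.Permutation.Propositional.Properties
  using (++-comm; ↭-length; ∈-resp-↭)
open import Data.List.Relation.Binary.Sublist.Propositional
  using (_⊆_; []; _∷_; _∷ʳ_; from∈; lookup)
open import Data.List.Relation.Binary.Sublist.Propositional.Properties
  using (++⁺; []⊆-universal; All-resp-⊆)
open import Data.List.Relation.Unary.All as All using (All; []; _∷_)
open import Data.List.Relation.Unary.All.Properties using (all⁺; all⁻)
open import Data.List.Relation.Unary.AllPairs using (AllPairs; []; _∷_)
import Data.List.Relation.Unary.AllPairs.Properties as AllPairs
open import Data.List.Relation.Unary.Any using (here; there)
open import Data.List.Relation.Unary.Any.Properties using (any⁺; any⁻)
open import Data.List.Relation.Unary.Unique.Propositional using (Unique)
import Data.List.Relation.Unary.Unique.Propositional.Properties as Unique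
open import Data.Maybe using (just)
open import Data.Maybe.Properties using (just-injective)
open import Data.Nat
  using (ℕ; zero; suc; _+_; _*_; _∸_; _≤_; _<_; _≡ᵇ_; _<ᵇ_; z≤n; s≤s; z<s; s<s; s≤s⁻¹; s<s⁻¹)
open import Data.Nat.Properties
open import Data.Product using (∃-syntax; _×_; _,_; proj₁; proj₂)
open import Data.Sum using (_⊎_; inj₁; inj₂)
open import Data.Unit using (⊤)
open import Function.Base using (_∘_)
open import Function.Bundles using (Equivalence; mk⇔)
open import Relation.Binary using (tri<; tri≈; tri>)
open import Relation.Binary.PropositionalEquality
  using (_≡_; _≢_; refl; sym; trans; cong; cong₂; subst; module ≡-Reasoning)
open import Relation.Nullary using (¬_; yes; no)
open import Relation.Nullary.Decidable using (⌊_⌋; T?)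

open import Defs

open ≡-Reasoning

variable
  x y z j m n v : ℕ
  τ σ π A B xs ys us vs : List ℕ

∧-proj₁ : ∀ a {b} → T (a ∧ b) → T a
∧-proj₁ a t = proj₁ (Equivalence.to (T-∧ {a}) t)

∧-proj₂ : ∀ a {b} → T (a ∧ b) → T b
∧-proj₂ a t = proj₂ (Equivalence.to (T-∧ {a}) t)

¬T⇒≡false : ∀ {b} → ¬ T b → b ≡ false
¬T⇒≡false {false} _ = refl
¬T⇒≡false {true} ¬t = ⊥-elim (¬t _)

T-not⇒¬T : ∀ {b} → T (not b) → ¬ T b
T-not⇒¬T {false} _ ()

¬T⇒T-not : ∀ {b} → ¬ T b → T (not b)
¬T⇒T-not {false} _  = _
¬T⇒T-not {true}  ¬t = ¬t _

≢⇒≡ᵇ≡false : m ≢ n → (m ≡ᵇ n) ≡ false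
≢⇒≡ᵇ≡false m≢n = ¬T⇒≡false (λ t → m≢n (≡ᵇ⇒≡ _ _ t))

≮⇒<ᵇ≡false : ¬ m < n → (m <ᵇ n) ≡ false
≮⇒<ᵇ≡false m≮n = ¬T⇒≡false (λ t → m≮n (<ᵇ⇒< _ _ t))

<⇒<ᵇ≡true : m < n → (m <ᵇ n) ≡ true
<⇒<ᵇ≡true m<n = Equivalence.to T-≡ (<⇒<ᵇ m<n)

≡ᵇ-refl : ∀ m → (m ≡ᵇ m) ≡ true
≡ᵇ-refl m = Equivalence.to T-≡ (≡⇒≡ᵇ m m refl)

<ᵇ-irrefl : ∀ m → (m <ᵇ m) ≡ false
<ᵇ-irrefl m = ≮⇒<ᵇ≡false (n≮n m)

≡ᵇ-<-false : x < y → (x ≡ᵇ y) ≡ false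
≡ᵇ-<-false x<y = ≢⇒≡ᵇ≡false (<⇒≢ x<y)

≡ᵇ->-false : x < y → (y ≡ᵇ x) ≡ false
≡ᵇ->-false x<y = ≢⇒≡ᵇ≡false (>⇒≢ x<y)

<ᵇ->-false : x < y → (y <ᵇ x) ≡ false
<ᵇ->-false x<y = ≮⇒<ᵇ≡false (<⇒≯ x<y)

T-all-lookup : ∀ {X : Set} (p : X → Bool) {xs a} → T (all p xs) → a ∈ xs → T (p a)
T-all-lookup p t a∈ = All.lookup (all⁺ p _ t) a∈

≟ᵇ-sound : ∀ p q → T ⌊ p ≟ᵇ q ⌋ → p ≡ q
≟ᵇ-sound false false _ = refl
≟ᵇ-sound true  true  _ = refl

≟ᵇ-sound₂ : ∀ p q r s → T (⌊ p ≟ᵇ q ⌋ ∧ ⌊ r ≟ᵇ s ⌋) → p ≡ q × r ≡ s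
≟ᵇ-sound₂ false false r s t = refl , ≟ᵇ-sound r s t
≟ᵇ-sound₂ true  true  r s t = refl , ≟ᵇ-sound r s t
≟ᵇ-sound₂ false true  r s ()
≟ᵇ-sound₂ true  false r s ()

-- Pattern avoidance through sublists

data Forbidden : List ℕ → Set where
  shape132  : x < z → z < y → Forbidden (x ∷ y ∷ z ∷ [])
  shape213  : y < x → x < z → Forbidden (x ∷ y ∷ z ∷ [])
  shape321  : y < x → z < y → Forbidden (x ∷ y ∷ z ∷ [])
  shape1212 : x < y → Forbidden (x ∷ y ∷ x ∷ y ∷ [])
  shape2121 : x < y → Forbidden (y ∷ x ∷ y ∷ x ∷ [])

Avoiding : List ℕ → Set
Avoiding π = ∀ {τ} → τ ⊆ π → ¬ Forbidden τ

Λ : List (List ℕ)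
Λ = (1 ∷ 3 ∷ 2 ∷ []) ∷ (2 ∷ 1 ∷ 3 ∷ []) ∷ (3 ∷ 2 ∷ 1 ∷ []) ∷ []

forbidden : List (List ℕ)
forbidden = (1 ∷ 2 ∷ 1 ∷ 2 ∷ []) ∷ (2 ∷ 1 ∷ 2 ∷ 1 ∷ []) ∷ Λ

-- Boxing T (orderIso τ σ) lets Agda infer τ and σ from the proof.
record OrderIso (τ σ : List ℕ) : Set where
  constructor ⟨_⟩
  field holds : T (orderIso τ σ)

orderIso⇒length : OrderIso τ σ → length τ ≡ length σ
orderIso⇒length {τ} {σ} ⟨ t ⟩ = ≡ᵇ⇒≡ _ _ (∧-proj₁ (length τ ≡ᵇ length σ) t)

-- Positions are bounded with _<ᵇ_ so that for literals the bounds are just _.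
module _ (iso : OrderIso τ σ) (a b : ℕ)
         (a< : T (a <ᵇ length σ)) (b< : T (b <ᵇ length σ)) where

  private
    position : ∀ {i} → T (i <ᵇ length σ) → i ∈ upTo (length σ)
    position i< = ∈-upTo⁺ (<ᵇ⇒< _ _ i<)

    comparisons : (at τ a ≡ᵇ at τ b) ≡ (at σ a ≡ᵇ at σ b) × (at τ a <ᵇ at τ b) ≡ (at σ a <ᵇ at σ b)
    comparisons = ≟ᵇ-sound₂ _ _ _ _
      (T-all-lookup _ (T-all-lookup _ (∧-proj₂ (length τ ≡ᵇ length σ) (OrderIso.holds iso)) (position a<)) (position b<))

  orderIso-≡ : T (at σ a ≡ᵇ at σ b) → at τ a ≡ at τ b
  orderIso-≡ t = ≡ᵇ⇒≡ _ _ (subst T (sym (proj₁ comparisons)) t)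

  orderIso-< : T (at σ a <ᵇ at σ b) → at τ a < at τ b
  orderIso-< t = <ᵇ⇒< _ _ (subst T (sym (proj₂ comparisons)) t)

shape₃ : length τ ≡ 3 → ∃[ x ] ∃[ y ] ∃[ z ] τ ≡ x ∷ y ∷ z ∷ []
shape₃ {x ∷ y ∷ z ∷ []} refl = x , y , z , refl
shape₃ {[]} ()
shape₃ {_ ∷ []} ()
shape₃ {_ ∷ _ ∷ []} ()
shape₃ {_ ∷ _ ∷ _ ∷ _ ∷ _} ()

shape₄ : length τ ≡ 4 → ∃[ x ] ∃[ y ] ∃[ z ] ∃[ w ] τ ≡ x ∷ y ∷ z ∷ w ∷ []
shape₄ {x ∷ y ∷ z ∷ w ∷ []} refl = x , y , z , w , refl
shape₄ {[]} ()
shape₄ {_ ∷ []} ()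
shape₄ {_ ∷ _ ∷ []} ()
shape₄ {_ ∷ _ ∷ _ ∷ []} ()
shape₄ {_ ∷ _ ∷ _ ∷ _ ∷ _ ∷ _} ()

orderIso⇒Forbidden : σ ∈ forbidden → OrderIso τ σ → Forbidden τ
orderIso⇒Forbidden {τ = τ} (here refl) iso with shape₄ {τ} (orderIso⇒length iso)
... | _ , _ , _ , _ , refl with orderIso-≡ iso 0 2 _ _ _ | orderIso-≡ iso 1 3 _ _ _
... | refl | refl = shape1212 (orderIso-< iso 0 1 _ _ _)
orderIso⇒Forbidden {τ = τ} (there (here refl)) iso with shape₄ {τ} (orderIso⇒length iso)
... | _ , _ , _ , _ , refl with orderIso-≡ iso 0 2 _ _ _ | orderIso-≡ iso 1 3 _ _ _
... | refl | refl = shape2121 (orderIso-< iso 1 0 _ _ _)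
orderIso⇒Forbidden {τ = τ} (there (there (here refl))) iso with shape₃ {τ} (orderIso⇒length iso)
... | _ , _ , _ , refl = shape132 (orderIso-< iso 0 2 _ _ _) (orderIso-< iso 2 1 _ _ _)
orderIso⇒Forbidden {τ = τ} (there (there (there (here refl)))) iso with shape₃ {τ} (orderIso⇒length iso)
... | _ , _ , _ , refl = shape213 (orderIso-< iso 1 0 _ _ _) (orderIso-< iso 0 2 _ _ _)
orderIso⇒Forbidden {τ = τ} (there (there (there (there (here refl))))) iso with shape₃ {τ} (orderIso⇒length iso)
... | _ , _ , _ , refl = shape321 (orderIso-< iso 1 0 _ _ _) (orderIso-< iso 2 1 _ _ _)

module _ {x y : ℕ} (x<y : x < y) where

  iso1212 : T (orderIso (x ∷ y ∷ x ∷ y ∷ []) (1 ∷ 2 ∷ 1 ∷ 2 ∷ []))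
  iso1212 rewrite ≡ᵇ-refl x | ≡ᵇ-refl y | <ᵇ-irrefl x | <ᵇ-irrefl y
    | ≡ᵇ-<-false x<y | ≡ᵇ->-false x<y | <⇒<ᵇ≡true x<y | <ᵇ->-false x<y = _

  iso2121 : T (orderIso (y ∷ x ∷ y ∷ x ∷ []) (2 ∷ 1 ∷ 2 ∷ 1 ∷ []))
  iso2121 rewrite ≡ᵇ-refl x | ≡ᵇ-refl y | <ᵇ-irrefl x | <ᵇ-irrefl y
    | ≡ᵇ-<-false x<y | ≡ᵇ->-false x<y | <⇒<ᵇ≡true x<y | <ᵇ->-false x<y = _

module _ {u v w : ℕ} (u<v : u < v) (v<w : v < w) where

  private
    u<w : u < w
    u<w = <-trans u<v v<w

  iso132 : T (orderIso (u ∷ w ∷ v ∷ []) (1 ∷ 3 ∷ 2 ∷ []))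
  iso132 rewrite ≡ᵇ-refl u | ≡ᵇ-refl v | ≡ᵇ-refl w | <ᵇ-irrefl u | <ᵇ-irrefl v | <ᵇ-irrefl w
    | ≡ᵇ-<-false u<v | ≡ᵇ->-false u<v | <⇒<ᵇ≡true u<v | <ᵇ->-false u<v
    | ≡ᵇ-<-false v<w | ≡ᵇ->-false v<w | <⇒<ᵇ≡true v<w | <ᵇ->-false v<w
    | ≡ᵇ-<-false u<w | ≡ᵇ->-false u<w | <⇒<ᵇ≡true u<w | <ᵇ->-false u<w = _

  iso213 : T (orderIso (v ∷ u ∷ w ∷ []) (2 ∷ 1 ∷ 3 ∷ []))
  iso213 rewrite ≡ᵇ-refl u | ≡ᵇ-refl v | ≡ᵇ-refl w | <ᵇ-irrefl u | <ᵇ-irrefl v | <ᵇ-irrefl w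
    | ≡ᵇ-<-false u<v | ≡ᵇ->-false u<v | <⇒<ᵇ≡true u<v | <ᵇ->-false u<v
    | ≡ᵇ-<-false v<w | ≡ᵇ->-false v<w | <⇒<ᵇ≡true v<w | <ᵇ->-false v<w
    | ≡ᵇ-<-false u<w | ≡ᵇ->-false u<w | <⇒<ᵇ≡true u<w | <ᵇ->-false u<w = _

  iso321 : T (orderIso (w ∷ v ∷ u ∷ []) (3 ∷ 2 ∷ 1 ∷ []))
  iso321 rewrite ≡ᵇ-refl u | ≡ᵇ-refl v | ≡ᵇ-refl w | <ᵇ-irrefl u | <ᵇ-irrefl v | <ᵇ-irrefl w
    | ≡ᵇ-<-false u<v | ≡ᵇ->-false u<v | <⇒<ᵇ≡true u<v | <ᵇ->-false u<v
    | ≡ᵇ-<-false v<w | ≡ᵇ->-false v<w | <⇒<ᵇ≡true v<w | <ᵇ->-false v<w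
    | ≡ᵇ-<-false u<w | ≡ᵇ->-false u<w | <⇒<ᵇ≡true u<w | <ᵇ->-false u<w = _

Forbidden⇒orderIso : Forbidden τ → ∃[ σ ] σ ∈ forbidden × OrderIso τ σ
Forbidden⇒orderIso (shape1212 x<y)   = _ , here refl , ⟨ iso1212 x<y ⟩
Forbidden⇒orderIso (shape2121 x<y)   = _ , there (here refl) , ⟨ iso2121 x<y ⟩
Forbidden⇒orderIso (shape132 x<z z<y) = _ , there (there (here refl)) , ⟨ iso132 x<z z<y ⟩
Forbidden⇒orderIso (shape213 y<x x<z) = _ , there (there (there (here refl))) , ⟨ iso213 y<x x<z ⟩
Forbidden⇒orderIso (shape321 y<x z<y) = _ , there (there (there (there (here refl)))) , ⟨ iso321 z<y y<x ⟩

⊆⇒∈subseqs : τ ⊆ π → τ ∈ subseqs π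
⊆⇒∈subseqs []          = here refl
⊆⇒∈subseqs (y ∷ʳ τ⊆π)  = ∈-++⁺ʳ _ (⊆⇒∈subseqs τ⊆π)
⊆⇒∈subseqs (refl ∷ τ⊆π) = ∈-++⁺ˡ (∈-map⁺ _ (⊆⇒∈subseqs τ⊆π))

∈subseqs⇒⊆ : ∀ π → τ ∈ subseqs π → τ ⊆ π
∈subseqs⇒⊆ [] (here refl) = []
∈subseqs⇒⊆ (y ∷ π) τ∈ with ∈-++⁻ (map (y ∷_) (subseqs π)) τ∈
... | inj₂ τ∈′ = y ∷ʳ ∈subseqs⇒⊆ π τ∈′
... | inj₁ yτ∈ with ∈-map⁻ (y ∷_) yτ∈
...   | _ , τ∈′ , refl = refl ∷ ∈subseqs⇒⊆ π τ∈′

avoidsAll⇒Avoiding : T (avoidsAll π forbidden) → Avoiding π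
avoidsAll⇒Avoiding {π} t τ⊆π f with Forbidden⇒orderIso f
... | σ , σ∈ , ⟨ iso ⟩ =
  T-not⇒¬T (T-all-lookup (avoids π) t σ∈) (any⁺ _ (lose (⊆⇒∈subseqs τ⊆π) iso))

Avoiding⇒avoidsAll : Avoiding π → T (avoidsAll π forbidden)
Avoiding⇒avoidsAll {π} av = all⁻ (avoids π) (All.tabulate λ σ∈ → ¬T⇒T-not λ t →
  let _ , τ∈ , iso = find (any⁻ _ (subseqs π) t)
  in  av (∈subseqs⇒⊆ π τ∈) (orderIso⇒Forbidden σ∈ ⟨ iso ⟩))

-- Words made of two sorted runs

Sorted : List ℕ → Set
Sorted = AllPairs _≤_

Dominates : List ℕ → List ℕ → Set
Dominates A B = ∀ {a b} → a ∈ A → b ∈ B → b ≤ a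

sorted-⊆ : τ ⊆ π → Sorted π → Sorted τ
sorted-⊆ []           _          = []
sorted-⊆ (_ ∷ʳ τ⊆π)   (_ ∷ sπ)   = sorted-⊆ τ⊆π sπ
sorted-⊆ (refl ∷ τ⊆π) (x≤π ∷ sπ) = All-resp-⊆ τ⊆π x≤π ∷ sorted-⊆ τ⊆π sπ

⊆-++-split : ∀ A {B} → τ ⊆ A ++ B → ∃[ τ₁ ] ∃[ τ₂ ] τ ≡ τ₁ ++ τ₂ × τ₁ ⊆ A × τ₂ ⊆ B
⊆-++-split []      τ⊆B          = [] , _ , refl , [] , τ⊆B
⊆-++-split (a ∷ A) (_ ∷ʳ τ⊆)    with ⊆-++-split A τ⊆
... | τ₁ , τ₂ , refl , τ₁⊆ , τ₂⊆ = τ₁ , τ₂ , refl , a ∷ʳ τ₁⊆ , τ₂⊆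
⊆-++-split (a ∷ A) (refl ∷ τ⊆) with ⊆-++-split A τ⊆
... | τ₁ , τ₂ , refl , τ₁⊆ , τ₂⊆ = a ∷ τ₁ , τ₂ , refl , refl ∷ τ₁⊆ , τ₂⊆

forbidden-not-runs : ∀ τ₁ τ₂ → Sorted τ₁ → Sorted τ₂ → Dominates τ₁ τ₂ → ¬ Forbidden (τ₁ ++ τ₂)
forbidden-not-runs [] _ _ (_ ∷ (y≤z ∷ _) ∷ _) _ (shape132 _ z<y) = ≤⇒≯ y≤z z<y
forbidden-not-runs [] _ _ ((x≤y ∷ _) ∷ _)     _ (shape213 y<x _) = ≤⇒≯ x≤y y<x
forbidden-not-runs [] _ _ ((x≤y ∷ _) ∷ _)     _ (shape321 y<x _) = ≤⇒≯ x≤y y<x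
forbidden-not-runs [] _ _ (_ ∷ (y≤x ∷ _) ∷ _) _ (shape1212 x<y)  = ≤⇒≯ y≤x x<y
forbidden-not-runs [] _ _ ((y≤x ∷ _) ∷ _)     _ (shape2121 x<y)  = ≤⇒≯ y≤x x<y
forbidden-not-runs (_ ∷ []) _ _ ((y≤z ∷ _) ∷ _)     _ (shape132 _ z<y) = ≤⇒≯ y≤z z<y
forbidden-not-runs (_ ∷ []) _ _ _                   d (shape213 _ x<z) = ≤⇒≯ (d (here refl) (there (here refl))) x<z
forbidden-not-runs (_ ∷ []) _ _ ((y≤z ∷ _) ∷ _)     _ (shape321 _ z<y) = ≤⇒≯ y≤z z<y
forbidden-not-runs (_ ∷ []) _ _ ((y≤x ∷ _) ∷ _)     _ (shape1212 x<y)  = ≤⇒≯ y≤x x<y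
forbidden-not-runs (_ ∷ []) _ _ (_ ∷ (y≤x ∷ _) ∷ _) _ (shape2121 x<y)  = ≤⇒≯ y≤x x<y
forbidden-not-runs (_ ∷ _ ∷ []) _ _             _ d (shape132 x<z _) = ≤⇒≯ (d (here refl) (here refl)) x<z
forbidden-not-runs (_ ∷ _ ∷ []) _ ((x≤y ∷ _) ∷ _) _ _ (shape213 y<x _) = ≤⇒≯ x≤y y<x
forbidden-not-runs (_ ∷ _ ∷ []) _ ((x≤y ∷ _) ∷ _) _ _ (shape321 y<x _) = ≤⇒≯ x≤y y<x
forbidden-not-runs (_ ∷ _ ∷ []) _ _             _ d (shape1212 x<y)  = ≤⇒≯ (d (here refl) (there (here refl))) x<y
forbidden-not-runs (_ ∷ _ ∷ []) _ ((y≤x ∷ _) ∷ _) _ _ (shape2121 x<y)  = ≤⇒≯ y≤x x<y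
forbidden-not-runs (_ ∷ _ ∷ _ ∷ []) _ (_ ∷ (y≤z ∷ _) ∷ _) _ _ (shape132 _ z<y) = ≤⇒≯ y≤z z<y
forbidden-not-runs (_ ∷ _ ∷ _ ∷ []) _ ((x≤y ∷ _) ∷ _)     _ _ (shape213 y<x _) = ≤⇒≯ x≤y y<x
forbidden-not-runs (_ ∷ _ ∷ _ ∷ []) _ ((x≤y ∷ _) ∷ _)     _ _ (shape321 y<x _) = ≤⇒≯ x≤y y<x
forbidden-not-runs (_ ∷ _ ∷ _ ∷ []) _ (_ ∷ (y≤x ∷ _) ∷ _) _ _ (shape1212 x<y)  = ≤⇒≯ y≤x x<y
forbidden-not-runs (_ ∷ _ ∷ _ ∷ []) _ ((y≤x ∷ _) ∷ _)     _ _ (shape2121 x<y)  = ≤⇒≯ y≤x x<y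
forbidden-not-runs (_ ∷ _ ∷ _ ∷ _ ∷ []) _ (_ ∷ (y≤x ∷ _) ∷ _) _ _ (shape1212 x<y) = ≤⇒≯ y≤x x<y
forbidden-not-runs (_ ∷ _ ∷ _ ∷ _ ∷ []) _ ((y≤x ∷ _) ∷ _)     _ _ (shape2121 x<y) = ≤⇒≯ y≤x x<y

runs⇒Avoiding : Sorted A → Sorted B → Dominates A B → Avoiding (A ++ B)
runs⇒Avoiding {A} sA sB dom τ⊆ with ⊆-++-split A τ⊆
... | τ₁ , τ₂ , refl , τ₁⊆A , τ₂⊆B =
  forbidden-not-runs τ₁ τ₂ (sorted-⊆ τ₁⊆A sA) (sorted-⊆ τ₂⊆B sB)
    (λ a∈ b∈ → dom (lookup τ₁⊆A a∈) (lookup τ₂⊆B b∈))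

-- The cut between the runs sits at a strict descent; this invariant is what lets a new
-- first letter be absorbed.
Descends : List ℕ → List ℕ → Set
Descends A []      = ⊤
Descends A (b ∷ _) = ∃[ a ] a ∈ A × b < a

descends-∷ : Descends A B → Descends (x ∷ A) B
descends-∷ {B = []}    _             = _
descends-∷ {B = _ ∷ _} (a , a∈ , b<a) = a , there a∈ , b<a

data TwoRuns : List ℕ → Set where
  twoRuns : ∀ {front back} → Sorted front → Sorted back →
            Dominates front back → Descends front back → TwoRuns (front ++ back)

first≮back : Avoiding (x ∷ A ++ B) → Dominates A B → Descends A B → ∀ {b} → b ∈ B → ¬ x < b
first≮back {x} {A} {q ∷ B} av dom (p , p∈ , q<p) {b} b∈ x<b with <-cmp b p
... | tri< b<p _ _ = av (refl ∷ ++⁺ (from∈ p∈) (from∈ b∈)) (shape132 x<b b<p)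
... | tri> _ _ p<b = <⇒≱ p<b (dom p∈ b∈)
... | tri≈ _ refl _ with b∈ | <-cmp q x
...   | here refl | _             = <-irrefl refl q<p
...   | there b∈B | tri< q<x _ _  = av (refl ∷ ++⁺ ([]⊆-universal A) (refl ∷ from∈ b∈B)) (shape213 q<x x<b)
...   | there _   | tri> _ _ x<q  = av (refl ∷ ++⁺ (from∈ p∈) (refl ∷ []⊆-universal B)) (shape132 x<q q<p)
...   | there b∈B | tri≈ _ refl _ = av (refl ∷ ++⁺ (from∈ p∈) (refl ∷ from∈ b∈B)) (shape1212 x<b)

ascent⇒¬Descends : Avoiding (x ∷ (y ∷ A) ++ z ∷ B) → y < x → ¬ Descends (y ∷ A) (z ∷ B)
ascent⇒¬Descends {A = A} {B = B} av y<x (_ , here refl , z<y) =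
  av (refl ∷ refl ∷ ++⁺ ([]⊆-universal A) (refl ∷ []⊆-universal B)) (shape321 y<x z<y)
ascent⇒¬Descends {x} {y} {A} {z} {B} av y<x (p , there p∈A , z<p) with <-cmp x p
... | tri> _ _ p<x = av (refl ∷ y ∷ʳ ++⁺ (from∈ p∈A) (refl ∷ []⊆-universal B)) (shape321 p<x z<p)
... | tri< x<p _ _ = av (refl ∷ refl ∷ ++⁺ (from∈ p∈A) ([]⊆-universal _)) (shape213 y<x x<p)
... | tri≈ _ refl _ with <-cmp z y
...   | tri< z<y _ _  = av (refl ∷ refl ∷ ++⁺ ([]⊆-universal A) (refl ∷ []⊆-universal B)) (shape321 y<x z<y)
...   | tri> _ _ y<z  = av (x ∷ʳ refl ∷ ++⁺ (from∈ p∈A) (refl ∷ []⊆-universal B)) (shape132 y<z z<p)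
...   | tri≈ _ refl _ = av (refl ∷ refl ∷ ++⁺ (from∈ p∈A) (refl ∷ []⊆-universal B)) (shape2121 y<x)

front-below-first : Avoiding (x ∷ (y ∷ A) ++ B) → y < x → ∀ {a} → a ∈ y ∷ A → a ≤ x
front-below-first av y<x (here refl) = <⇒≤ y<x
front-below-first av y<x (there a∈A) =
  ≮⇒≥ λ x<a → av (refl ∷ refl ∷ ++⁺ (from∈ a∈A) ([]⊆-universal _)) (shape213 y<x x<a)

ascent⇒back≡[] : Avoiding (x ∷ (y ∷ A) ++ B) → y < x → Descends (y ∷ A) B → B ≡ []
ascent⇒back≡[] {B = []}    _  _   _    = refl
ascent⇒back≡[] {B = _ ∷ _} av y<x desc = ⊥-elim (ascent⇒¬Descends av y<x desc)

sorted-min : Sorted (x ∷ xs) → v ∈ x ∷ xs → x ≤ v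
sorted-min _          (here refl) = ≤-refl
sorted-min (x≤xs ∷ _) (there v∈)  = All.lookup x≤xs v∈

sorted-∷ : x ≤ y → Sorted (y ∷ A) → Sorted (x ∷ y ∷ A)
sorted-∷ x≤y sA@(y≤A ∷ _) = (x≤y ∷ All.map (≤-trans x≤y) y≤A) ∷ sA

TwoRuns-∷ : Avoiding (x ∷ π) → TwoRuns π → TwoRuns (x ∷ π)
TwoRuns-∷ _ (twoRuns {[]} {[]} _ _ _ _) = twoRuns ([] ∷ []) [] (λ _ ()) _
TwoRuns-∷ _ (twoRuns {[]} {_ ∷ _} _ _ _ (_ , () , _))
TwoRuns-∷ {x} av (twoRuns {y ∷ A} {B} sA sB dom desc) with ≤-<-connex x y
... | inj₁ x≤y = twoRuns {x ∷ y ∷ A} (sorted-∷ x≤y sA) sB dom′ (descends-∷ desc)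
  where
  dom′ : Dominates (x ∷ y ∷ A) B
  dom′ (here refl) b∈ = ≮⇒≥ (first≮back av dom desc b∈)
  dom′ (there a∈)  b∈ = dom a∈ b∈
... | inj₂ y<x with refl ← ascent⇒back≡[] av y<x desc =
  subst (λ w → TwoRuns (x ∷ w)) (sym (++-identityʳ (y ∷ A)))
    (twoRuns {[ x ]} ([] ∷ []) sA (λ { (here refl) → front-below-first av y<x }) (x , here refl , y<x))

Avoiding⇒TwoRuns : ∀ π → Avoiding π → TwoRuns π
Avoiding⇒TwoRuns []      _  = twoRuns {[]} {[]} [] [] (λ ()) _
Avoiding⇒TwoRuns (x ∷ π) av = TwoRuns-∷ av (Avoiding⇒TwoRuns π (λ τ⊆π → av (x ∷ʳ τ⊆π)))

SameCounts : List ℕ → List ℕ → Set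
SameCounts xs ys = ∀ v → occ v xs ≡ occ v ys

occ-here : ∀ v xs → occ v (v ∷ xs) ≡ suc (occ v xs)
occ-here v xs rewrite ≡ᵇ-refl v = refl

occ-there : ∀ {v x} xs → v ≢ x → occ v (x ∷ xs) ≡ occ v xs
occ-there {v} {x} xs v≢x rewrite ≢⇒≡ᵇ≡false v≢x = refl

occ-++ : ∀ v xs ys → occ v (xs ++ ys) ≡ occ v xs + occ v ys
occ-++ v []       ys = refl
occ-++ v (x ∷ xs) ys with v ≡ᵇ x
... | true  = cong suc (occ-++ v xs ys)
... | false = occ-++ v xs ys

occ-∉ : v ∉ xs → occ v xs ≡ 0
occ-∉ {xs = []}     _   = refl
occ-∉ {v} {x ∷ xs} v∉ rewrite occ-there xs (λ v≡x → v∉ (here v≡x)) = occ-∉ (λ v∈ → v∉ (there v∈))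

occ≢0⇒∈ : occ v xs ≢ 0 → v ∈ xs
occ≢0⇒∈ {v} {[]}     occ≢0 = ⊥-elim (occ≢0 refl)
occ≢0⇒∈ {v} {x ∷ xs} occ≢0 with v ≡ᵇ x in eq
... | true  = here (≡ᵇ⇒≡ v x (Equivalence.from T-≡ eq))
... | false = there (occ≢0⇒∈ occ≢0)

∈⇒occ≢0 : v ∈ xs → occ v xs ≢ 0
∈⇒occ≢0 {v} (here {xs = xs} refl) rewrite occ-here v xs = λ ()
∈⇒occ≢0 {v} (there {x = x} v∈) with v ≡ᵇ x
... | true  = λ ()
... | false = ∈⇒occ≢0 v∈

occ-∷-cancel : ∀ {v x} xs ys → occ v (x ∷ xs) ≡ occ v (x ∷ ys) → occ v xs ≡ occ v ys
occ-∷-cancel {v} {x} xs ys eq with v ≡ᵇ x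
... | true  = suc-injective eq
... | false = eq

occ-∷-cong : ∀ {v x} xs ys → occ v xs ≡ occ v ys → occ v (x ∷ xs) ≡ occ v (x ∷ ys)
occ-∷-cong {v} {x} xs ys eq with v ≡ᵇ x
... | true  = cong suc eq
... | false = eq

occ-↭ : xs ↭ ys → SameCounts xs ys
occ-↭ ↭.refl v = refl
occ-↭ (↭.prep x p) v with v ≡ᵇ x
... | true  = cong suc (occ-↭ p v)
... | false = occ-↭ p v
occ-↭ (↭.swap x y p) v with v ≡ᵇ x | v ≡ᵇ y
... | true  | true  = cong (suc ∘ suc) (occ-↭ p v)
... | true  | false = cong suc (occ-↭ p v)
... | false | true  = cong suc (occ-↭ p v)
... | false | false = occ-↭ p v
occ-↭ (↭.trans p q) v = trans (occ-↭ p v) (occ-↭ q v)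

∈-resp-SameCounts : SameCounts xs ys → v ∈ xs → v ∈ ys
∈-resp-SameCounts {v = v} same v∈ = occ≢0⇒∈ (λ occ≡0 → ∈⇒occ≢0 v∈ (trans (same v) occ≡0))

sorted-unique : Sorted xs → Sorted ys → SameCounts xs ys → xs ≡ ys
sorted-unique [] [] _ = refl
sorted-unique {ys = y ∷ ys} [] _ same = ⊥-elim (∈⇒occ≢0 {xs = y ∷ ys} (here refl) (sym (same y)))
sorted-unique {xs = x ∷ xs} _ [] same = ⊥-elim (∈⇒occ≢0 {xs = x ∷ xs} (here refl) (same x))
sorted-unique {x ∷ xs} {y ∷ ys} sx@(_ ∷ sxs) sy@(_ ∷ sys) same
  with ≤-antisym (sorted-min sx (∈-resp-SameCounts {y ∷ ys} (sym ∘ same) (here refl)))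
                 (sorted-min sy (∈-resp-SameCounts {x ∷ xs} same (here refl)))
... | refl = cong (x ∷_) (sorted-unique sxs sys (λ v → occ-∷-cancel xs ys (same v)))

record RunsAround (m : ℕ) (front back : List ℕ) : Set where
  field
    front-sorted : Sorted front
    back-sorted  : Sorted back
    front-above  : ∀ {a} → a ∈ front → m ≤ a
    back-below   : ∀ {b} → b ∈ back → b ≤ m

open RunsAround

RunsAround⇒Avoiding : RunsAround m A B → Avoiding (A ++ B)
RunsAround⇒Avoiding r = runs⇒Avoiding (front-sorted r) (back-sorted r)
  (λ a∈ b∈ → ≤-trans (back-below r b∈) (front-above r a∈))

-- Away from m every letter lives in one run only, so the counts in the whole word fix the
-- counts in each run; at m that is the hypothesis.
runsAround-unique : RunsAround m xs ys → RunsAround m us vs → occ m xs ≡ occ m us →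
                    SameCounts (xs ++ ys) (us ++ vs) → xs ++ ys ≡ us ++ vs
runsAround-unique {m} {xs} {ys} {us} {vs} r r′ at-m same =
  cong₂ _++_ (sorted-unique (front-sorted r) (front-sorted r′) fronts)
             (sorted-unique (back-sorted r) (back-sorted r′) backs)
  where
  split : ∀ v → occ v xs + occ v ys ≡ occ v us + occ v vs
  split v = trans (sym (occ-++ v xs ys)) (trans (same v) (occ-++ v us vs))

  none-below : ∀ {zs} → (∀ {a} → a ∈ zs → m ≤ a) → v < m → occ v zs ≡ 0
  none-below above v<m = occ-∉ (λ v∈ → <⇒≱ v<m (above v∈))

  none-above : ∀ {zs} → (∀ {b} → b ∈ zs → b ≤ m) → m < v → occ v zs ≡ 0
  none-above below m<v = occ-∉ (λ v∈ → <⇒≱ m<v (below v∈))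

  fronts : SameCounts xs us
  fronts v with <-cmp v m
  ... | tri< v<m _ _  = trans (none-below (front-above r) v<m) (sym (none-below (front-above r′) v<m))
  ... | tri≈ _ refl _ = at-m
  ... | tri> _ _ m<v  = +-cancelʳ-≡ (occ v ys) _ _ (trans (split v) (cong (occ v us +_)
                          (trans (none-above (back-below r′) m<v) (sym (none-above (back-below r) m<v)))))

  backs : SameCounts ys vs
  backs v = +-cancelˡ-≡ (occ v xs) _ _ (trans (split v) (cong (_+ occ v vs) (sym (fronts v))))

-- Rotations of 1 1 2 2 ⋯ n n

doubled : ℕ → ℕ → List ℕ
doubled lo zero    = []
doubled lo (suc k) = lo ∷ lo ∷ doubled (suc lo) k

∈-doubled⁻ : ∀ lo k → v ∈ doubled lo k → lo ≤ v × v < lo + k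
∈-doubled⁻ lo (suc k) (here refl)         = ≤-refl , m<m+n lo z<s
∈-doubled⁻ lo (suc k) (there (here refl)) = ≤-refl , m<m+n lo z<s
∈-doubled⁻ {v} lo (suc k) (there (there v∈)) with ∈-doubled⁻ (suc lo) k v∈
... | lo<v , v<1+lo+k = <⇒≤ lo<v , subst (v <_) (sym (+-suc lo k)) v<1+lo+k

outside-range : ∀ {lo k} → v < lo ⊎ lo + k ≤ v → ¬ (lo ≤ v × v < lo + k)
outside-range (inj₁ v<lo) (lo≤v , _) = <⇒≱ v<lo lo≤v
outside-range (inj₂ hi≤v) (_ , v<hi) = <⇒≱ v<hi hi≤v

occ-doubled-outside : ∀ lo k → v < lo ⊎ lo + k ≤ v → occ v (doubled lo k) ≡ 0
occ-doubled-outside lo k out = occ-∉ λ v∈ → outside-range out (∈-doubled⁻ lo k v∈)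

occ-doubled-inside : ∀ lo k → lo ≤ v → v < lo + k → occ v (doubled lo k) ≡ 2
occ-doubled-inside lo zero lo≤v v<lo+0 = ⊥-elim (<⇒≱ (subst (_ <_) (+-identityʳ lo) v<lo+0) lo≤v)
occ-doubled-inside {v} lo (suc k) lo≤v v<hi with m≤n⇒m<n∨m≡n lo≤v
... | inj₂ refl
  rewrite occ-here lo (lo ∷ doubled (suc lo) k) | occ-here lo (doubled (suc lo) k)
        | occ-doubled-outside (suc lo) k (inj₁ (n<1+n lo)) = refl
... | inj₁ lo<v
  rewrite occ-there (lo ∷ doubled (suc lo) k) (>⇒≢ lo<v) | occ-there (doubled (suc lo) k) (>⇒≢ lo<v)
  = occ-doubled-inside (suc lo) k lo<v (subst (v <_) (+-suc lo k) v<hi)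

doubled-sorted : ∀ lo k → Sorted (doubled lo k)
doubled-sorted lo zero    = []
doubled-sorted lo (suc k) = (≤-refl ∷ lo≤rest) ∷ lo≤rest ∷ doubled-sorted (suc lo) k
  where
  lo≤rest : All (lo ≤_) (doubled (suc lo) k)
  lo≤rest = All.tabulate λ v∈ → <⇒≤ (proj₁ (∈-doubled⁻ (suc lo) k v∈))

length-doubled : ∀ lo k → length (doubled lo k) ≡ 2 * k
length-doubled lo zero    = refl
length-doubled lo (suc k) = trans (cong (2 +_) (length-doubled (suc lo) k)) (sym (*-suc 2 k))

doubled-++ : ∀ lo j k → doubled lo (j + k) ≡ doubled lo j ++ doubled (lo + j) k
doubled-++ lo zero    k rewrite +-identityʳ lo = refl
doubled-++ lo (suc j) k rewrite +-suc lo j = cong (λ w → lo ∷ lo ∷ w) (doubled-++ (suc lo) j k)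

-- evenRotation n j and oddRotation n j are 1 1 2 2 ⋯ n n rotated left by 2j and 2j + 1 places.
evenRotation oddRotation : ℕ → ℕ → List ℕ
evenRotation n j = doubled (suc j) (n ∸ j) ++ doubled 1 j
oddRotation  n j = (suc j ∷ doubled (2 + j) (n ∸ suc j)) ++ (doubled 1 j ++ [ suc j ])

rotationPair : ℕ → ℕ → List (List ℕ)
rotationPair n j = evenRotation n j ∷ oddRotation n j ∷ []

rotations : ℕ → List (List ℕ)
rotations n = concatMap (rotationPair n) (upTo n)

<⇒∸≡suc∸suc : ∀ {j n} → j < n → n ∸ j ≡ suc (n ∸ suc j)
<⇒∸≡suc∸suc = +-∸-assoc 1

module _ {n j : ℕ} (j<n : j < n) where

  private
    doubled-split : doubled 1 n ≡ doubled 1 j ++ doubled (suc j) (n ∸ j)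
    doubled-split = trans (cong (doubled 1) (sym (m+[n∸m]≡n (<⇒≤ j<n)))) (doubled-++ 1 j (n ∸ j))

  evenRotation↭ : evenRotation n j ↭ doubled 1 n
  evenRotation↭ = ↭-trans (++-comm (doubled (suc j) (n ∸ j)) (doubled 1 j)) (↭-reflexive (sym doubled-split))

  oddRotation↭ : oddRotation n j ↭ doubled 1 n
  oddRotation↭ = ↭-trans (++-comm (suc j ∷ doubled (2 + j) (n ∸ suc j)) (doubled 1 j ++ [ suc j ]))
    (↭-reflexive (begin
      (doubled 1 j ++ [ suc j ]) ++ suc j ∷ doubled (2 + j) (n ∸ suc j)
        ≡⟨ ++-assoc (doubled 1 j) [ suc j ] _ ⟩
      doubled 1 j ++ doubled (suc j) (suc (n ∸ suc j))
        ≡⟨ cong (λ k → doubled 1 j ++ doubled (suc j) k) (sym (<⇒∸≡suc∸suc j<n)) ⟩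
      doubled 1 j ++ doubled (suc j) (n ∸ j)
        ≡⟨ sym doubled-split ⟩
      doubled 1 n ∎))

  evenRotation-front-count : occ (suc j) (doubled (suc j) (n ∸ j)) ≡ 2
  evenRotation-front-count =
    occ-doubled-inside (suc j) (n ∸ j) ≤-refl (m<m+n (suc j) (subst (0 <_) (sym (<⇒∸≡suc∸suc j<n)) z<s))

  evenRotation∈rotations : evenRotation n j ∈ rotations n
  evenRotation∈rotations = ∈-concatMap⁺ (rotationPair n) (lose (∈-upTo⁺ j<n) (here refl))

  oddRotation∈rotations : oddRotation n j ∈ rotations n
  oddRotation∈rotations = ∈-concatMap⁺ (rotationPair n) (lose (∈-upTo⁺ j<n) (there (here refl)))

evenRotation-runs : ∀ n j → RunsAround (suc j) (doubled (suc j) (n ∸ j)) (doubled 1 j)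
evenRotation-runs n j = record
  { front-sorted = doubled-sorted (suc j) (n ∸ j)
  ; back-sorted  = doubled-sorted 1 j
  ; front-above  = λ a∈ → proj₁ (∈-doubled⁻ (suc j) (n ∸ j) a∈)
  ; back-below   = λ b∈ → <⇒≤ (proj₂ (∈-doubled⁻ 1 j b∈))
  }

oddRotation-runs : ∀ n j → RunsAround (suc j) (suc j ∷ doubled (2 + j) (n ∸ suc j)) (doubled 1 j ++ [ suc j ])
oddRotation-runs n j = record
  { front-sorted = All.tabulate (λ a∈ → <⇒≤ (above a∈)) ∷ doubled-sorted (2 + j) (n ∸ suc j)
  ; back-sorted  = AllPairs.++⁺ (doubled-sorted 1 j) ([] ∷ [])
                     (All.tabulate λ b∈ → <⇒≤ (proj₂ (∈-doubled⁻ 1 j b∈)) ∷ [])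
  ; front-above  = λ { (here refl) → ≤-refl ; (there a∈) → <⇒≤ (above a∈) }
  ; back-below   = below
  }
  where
  above : ∀ {a} → a ∈ doubled (2 + j) (n ∸ suc j) → suc j < a
  above a∈ = proj₁ (∈-doubled⁻ (2 + j) (n ∸ suc j) a∈)
  below : ∀ {b} → b ∈ doubled 1 j ++ [ suc j ] → b ≤ suc j
  below b∈ with ∈-++⁻ (doubled 1 j) b∈
  ... | inj₁ b∈′        = <⇒≤ (proj₂ (∈-doubled⁻ 1 j b∈′))
  ... | inj₂ (here refl) = ≤-refl

twoRuns-around : Sorted (x ∷ A) → Sorted B → Dominates (x ∷ A) B → RunsAround x (x ∷ A) B
twoRuns-around sF sB dom = record
  { front-sorted = sF ; back-sorted = sB ; front-above = sorted-min sF ; back-below = dom (here refl) }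

letter-range : SameCounts π (doubled 1 n) → v ∈ π → 1 ≤ v × v < 1 + n
letter-range {n = n} same v∈ = ∈-doubled⁻ 1 n (∈-resp-SameCounts same v∈)

matches-rotation : RunsAround m xs ys → RunsAround m us vs → occ m xs ≡ occ m us →
                   SameCounts (xs ++ ys) (doubled 1 n) → us ++ vs ↭ doubled 1 n →
                   us ++ vs ∈ rotations n → xs ++ ys ∈ rotations n
matches-rotation {n = n} r r′ at-m same ↭doubled ∈rotations = subst (_∈ rotations n)
  (sym (runsAround-unique r r′ at-m (λ v → trans (same v) (sym (occ-↭ ↭doubled v))))) ∈rotations

TwoRuns⇒∈rotations : 1 ≤ n → TwoRuns π → SameCounts π (doubled 1 n) → π ∈ rotations n
TwoRuns⇒∈rotations {n} 1≤n (twoRuns {[]} {[]} _ _ _ _) same =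
  ⊥-elim (0≢1+n (trans (same 1) (occ-doubled-inside 1 n ≤-refl (s≤s 1≤n))))
TwoRuns⇒∈rotations _ (twoRuns {[]} {_ ∷ _} _ _ _ (_ , () , _))
TwoRuns⇒∈rotations {n} _ (twoRuns {zero ∷ A} {B} _ _ _ _) same
  with letter-range {zero ∷ A ++ B} {n} same (here refl)
... | () , _
TwoRuns⇒∈rotations {n} _ (twoRuns {suc j ∷ A} {B} sF sB dom _) same
  with s≤s⁻¹ (proj₂ (letter-range {suc j ∷ A ++ B} {n} same (here refl)))
... | j<n with occ (suc j) A in count | total
  where
  total : occ (suc j) A + occ (suc j) B ≡ 1
  total = suc-injective (begin
    suc (occ (suc j) A + occ (suc j) B) ≡⟨ cong suc (occ-++ (suc j) A B) ⟨
    suc (occ (suc j) (A ++ B))          ≡⟨ occ-here (suc j) (A ++ B) ⟨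
    occ (suc j) (suc j ∷ A ++ B)        ≡⟨ same (suc j) ⟩
    occ (suc j) (doubled 1 n)           ≡⟨ occ-doubled-inside 1 n (s≤s z≤n) (s≤s j<n) ⟩
    2                                   ∎)
... | 0 | _ = matches-rotation (twoRuns-around sF sB dom) (oddRotation-runs n j) at-m same
                (oddRotation↭ j<n) (oddRotation∈rotations j<n)
  where
  at-m : occ (suc j) (suc j ∷ A) ≡ occ (suc j) (suc j ∷ doubled (2 + j) (n ∸ suc j))
  at-m = occ-∷-cong {x = suc j} A (doubled (2 + j) (n ∸ suc j))
           (trans count (sym (occ-doubled-outside (2 + j) (n ∸ suc j) (inj₁ (n<1+n (suc j))))))
... | 1 | _ = matches-rotation (twoRuns-around sF sB dom) (evenRotation-runs n j) at-m same
                (evenRotation↭ j<n) (evenRotation∈rotations j<n)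
  where
  at-m : occ (suc j) (suc j ∷ A) ≡ occ (suc j) (doubled (suc j) (n ∸ j))
  at-m = trans (occ-here (suc j) A) (trans (cong suc count) (sym (evenRotation-front-count j<n)))
... | suc (suc _) | ()

extensions : ℕ → List ℕ → List (List ℕ)
extensions n w = map (λ i → suc i ∷ w) (upTo n)

words-letters : ∀ k {w} → w ∈ words k n → v ∈ w → 1 ≤ v × v < 1 + n
words-letters zero (here refl) ()
words-letters {n} (suc k) w∈ v∈ with find (∈-concatMap⁻ (extensions n) {xs = words k n} w∈)
... | _ , w′∈ , ext∈ with ∈-map⁻ _ ext∈
...   | _ , i∈ , refl with v∈
...     | here refl = s≤s z≤n , s<s (∈-upTo⁻ i∈)
...     | there v∈′ = words-letters k w′∈ v∈′

∈-words⁺ : ∀ k {w} → length w ≡ k → (∀ {v} → v ∈ w → 1 ≤ v × v < 1 + n) → w ∈ words k n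
∈-words⁺ zero    {[]}        refl _ = here refl
∈-words⁺ (suc k) {zero ∷ _}  _ letters with letters (here refl)
... | () , _
∈-words⁺ {n} (suc k) {suc i ∷ w} len letters =
  ∈-concatMap⁺ (extensions n) (lose (∈-words⁺ k (suc-injective len) (λ v∈ → letters (there v∈)))
    (∈-map⁺ _ (∈-upTo⁺ (s<s⁻¹ (proj₂ (letters (here refl)))))))

unique-concatMap : ∀ {X Y : Set} (f : X → List Y) {xs} → Unique xs →
  (∀ {x} → x ∈ xs → Unique (f x)) →
  (∀ {x x′ y} → x ∈ xs → x′ ∈ xs → y ∈ f x → y ∈ f x′ → x ≡ x′) →
  Unique (concatMap f xs)
unique-concatMap f {[]}     _          _      _        = []
unique-concatMap f {x ∷ xs} (x∉ ∷ uxs) unique separate =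
  Unique.++⁺ (unique (here refl))
    (unique-concatMap f uxs (λ x′∈ → unique (there x′∈)) (λ x∈ x′∈ → separate (there x∈) (there x′∈)))
    λ (y∈fx , y∈rest) → let x′ , x′∈ , y∈fx′ = find (∈-concatMap⁻ f {xs = xs} y∈rest)
                        in  All.lookup x∉ x′∈ (separate (here refl) (there x′∈) y∈fx y∈fx′)

words-unique : ∀ k n → Unique (words k n)
words-unique zero    n = [] ∷ []
words-unique (suc k) n = unique-concatMap (extensions n) (words-unique k n)
  (λ _ → Unique.map⁺ (λ where refl → refl) (Unique.upTo⁺ n))
  (λ _ _ y∈ y∈′ → tails-agree (∈-map⁻ _ y∈) (∈-map⁻ _ y∈′))
  where
  tails-agree : ∀ {y w w′} → (∃[ i ] i ∈ upTo n × y ≡ suc i ∷ w) → (∃[ i ] i ∈ upTo n × y ≡ suc i ∷ w′) → w ≡ w′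
  tails-agree (_ , _ , y≡) (_ , _ , y≡′) = ∷-injectiveʳ (trans (sym y≡) y≡′)

rotationPair-head : j < n → π ∈ rotationPair n j → head π ≡ just (suc j)
rotationPair-head {j} {n} j<n (here refl) rewrite <⇒∸≡suc∸suc j<n = refl
rotationPair-head _ (there (here refl)) = refl

evenRotation≢oddRotation : 2 ≤ n → j < n → evenRotation n j ≢ oddRotation n j
-- The second letters differ (suc j against 2 + j, or against 1 once the front is used up);
-- only n = 1 makes the two rotations coincide.
evenRotation≢oddRotation {n} {j} 2≤n j<n rewrite <⇒∸≡suc∸suc j<n with n ∸ suc j in rest
... | suc _ = λ ()
... | zero with j
...   | suc _ = λ ()
...   | zero  = λ _ → <⇒≱ 2≤n (m∸n≡0⇒m≤n rest)

rotations-unique : 2 ≤ n → Unique (rotations n)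
rotations-unique {n} 2≤n = unique-concatMap (rotationPair n) (Unique.upTo⁺ n)
  (λ j∈ → (evenRotation≢oddRotation 2≤n (∈-upTo⁻ j∈) ∷ []) ∷ [] ∷ [])
  (λ j∈ j′∈ π∈ π∈′ → suc-injective (just-injective
    (trans (sym (rotationPair-head (∈-upTo⁻ j∈) π∈)) (rotationPair-head (∈-upTo⁻ j′∈) π∈′))))

length-rotations : ∀ n → length (rotations n) ≡ 2 * n
length-rotations n = trans (two-each (upTo n)) (cong (2 *_) (length-upTo n))
  where
  two-each : ∀ js → length (concatMap (rotationPair n) js) ≡ 2 * length js
  two-each []       = refl
  two-each (j ∷ js) = trans (cong (2 +_) (two-each js)) (sym (*-suc 2 (length js)))

rotation↭doubled×Avoiding : π ∈ rotations n → π ↭ doubled 1 n × Avoiding π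
rotation↭doubled×Avoiding {n = n} π∈ with find (∈-concatMap⁻ (rotationPair n) {xs = upTo n} π∈)
... | j , j∈ , here refl         = evenRotation↭ (∈-upTo⁻ j∈) , RunsAround⇒Avoiding (evenRotation-runs n j)
... | j , j∈ , there (here refl) = oddRotation↭ (∈-upTo⁻ j∈) , RunsAround⇒Avoiding (oddRotation-runs n j)

absent-letter : (∀ {v} → v ∈ π → 1 ≤ v × v < 1 + n) → v < 1 ⊎ 1 + n ≤ v →
                occ v π ≡ occ v (doubled 1 n)
absent-letter {n = n} letters out =
  trans (occ-∉ λ v∈ → outside-range out (letters v∈)) (sym (occ-doubled-outside 1 n out))

isMultiperm⇒SameCounts : (∀ {v} → v ∈ π → 1 ≤ v × v < 1 + n) → T (isMultiperm n π) →
                         SameCounts π (doubled 1 n)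
isMultiperm⇒SameCounts letters _ zero = absent-letter letters (inj₁ z<s)
isMultiperm⇒SameCounts {π} {n} letters t (suc i) with i <? n
... | yes i<n = trans (≡ᵇ⇒≡ (occ (suc i) π) 2 (T-all-lookup _ t (∈-upTo⁺ i<n)))
                      (sym (occ-doubled-inside 1 n (s≤s z≤n) (s<s i<n)))
... | no  i≮n = absent-letter letters (inj₂ (s≤s (≮⇒≥ i≮n)))

qualifies : ℕ → List ℕ → Bool
qualifies n π = isMultiperm n π ∧ avoidsAll π forbidden

Qbar⊆rotations : 1 ≤ n → π ∈ Qbar n Λ → π ∈ rotations n
Qbar⊆rotations {n} {π} 1≤n π∈ with ∈-filter⁻ (T? ∘ qualifies n) {xs = words (2 * n) n} π∈
... | π∈words , ok = TwoRuns⇒∈rotations 1≤n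
  (Avoiding⇒TwoRuns π (avoidsAll⇒Avoiding (∧-proj₂ (isMultiperm n π) ok)))
  (isMultiperm⇒SameCounts (words-letters (2 * n) π∈words) (∧-proj₁ (isMultiperm n π) ok))

rotations⊆Qbar : π ∈ rotations n → π ∈ Qbar n Λ
rotations⊆Qbar {π} {n} π∈ with rotation↭doubled×Avoiding π∈
... | π↭ , avoiding = ∈-filter⁺ (T? ∘ qualifies n)
  (∈-words⁺ (2 * n) (trans (↭-length π↭) (length-doubled 1 n)) (λ v∈ → ∈-doubled⁻ 1 n (∈-resp-↭ π↭ v∈)))
  (Equivalence.from T-∧ (multiperm , Avoiding⇒avoidsAll avoiding))
  where
  multiperm : T (isMultiperm n π)
  multiperm = all⁻ _ (All.tabulate λ {i} i∈ → ≡⇒≡ᵇ (occ (suc i) π) 2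
    (trans (occ-↭ π↭ (suc i)) (occ-doubled-inside 1 n (s≤s z≤n) (s<s (∈-upTo⁻ i∈)))))

Qbar↭rotations : 2 ≤ n → Qbar n Λ ↭ rotations n
Qbar↭rotations {n} 2≤n = ∼bag⇒↭ (unique∧set⇒bag
  (Unique.filter⁺ (T? ∘ qualifies n) (words-unique (2 * n) n))
  (rotations-unique 2≤n)
  (mk⇔ (Qbar⊆rotations (≤-trans (s≤s z≤n) 2≤n)) (rotations⊆Qbar {n = n})))

theorem4p9 : (n : ℕ) → 2 ≤ n →
    qbar n ((1 ∷ 3 ∷ 2 ∷ []) ∷ (2 ∷ 1 ∷ 3 ∷ []) ∷ (3 ∷ 2 ∷ 1 ∷ []) ∷ []) ≡ 2 * n
theorem4p9 n 2≤n = begin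
  qbar n Λ              ≡⟨ ↭-length (Qbar↭rotations {n} 2≤n) ⟩
  length (rotations n)  ≡⟨ length-rotations n ⟩
  2 * n                 ∎
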